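{- The function $n\mapsto r_2(n)/2^n$ has an exponentially decreasing upper bound: there exist constants $C>0$ and $0<c<1$ such that $r_2(n)/2^n\le C c^n$ for all $n\ge 0$.
   Context: A palindrome is a word equal to its reversal (the empty word is a palindrome). A finite word $w$ is rich if it has exactly $|w|+1$ distinct palindromic factors (counting the empty word). $r_k(n)$ denotes the number of rich words of length $n$ over a fixed alphabet with $k$ letters. -}

module Defs where

open import Data.Nat using (ℕ; zero; suc)
open import Data.Fin using (Fin)
open import Data.Fin.Properties using () renaming (_≟_ to _≟ᶠ_)
open import Data.List using (List; []; _∷_; length; reverse; filter; deduplicate; concatMap; map; inits; tails; allFin)
open import Data.List.Properties using (≡-dec)
open import Relation.Binary.PropositionalEquality using (_≡_)
open import Relation.Nullary using (Dec)
open import Data.Nat.Properties using () renaming (_≟_ to _≟ⁿ_)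
open import Data.Rational using (ℚ; 1ℚ; _*_)

Word : ℕ → Set
Word k = List (Fin k)

_≟w_ : ∀ {k} (u v : Word k) → Dec (u ≡ v)
_≟w_ = ≡-dec _≟ᶠ_

Palindrome : ∀ {k} → Word k → Set
Palindrome w = w ≡ reverse w

palindrome? : ∀ {k} (w : Word k) → Dec (Palindrome w)
palindrome? w = w ≟w reverse w

factors : ∀ {k} → Word k → List (Word k)
factors w = concatMap inits (tails w)

-- the distinct palindromic factors of w (empty word included)
distinctPalFactors : ∀ {k} → Word k → List (Word k)
distinctPalFactors w = deduplicate _≟w_ (filter palindrome? (factors w))

Rich : ∀ {k} → Word k → Set
Rich w = length (distinctPalFactors w) ≡ suc (length w)

rich? : ∀ {k} (w : Word k) → Dec (Rich w)
rich? w = length (distinctPalFactors w) ≟ⁿ suc (length w)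

wordsOfLength : (k n : ℕ) → List (Word k)
wordsOfLength k zero = [] ∷ []
wordsOfLength k (suc n) = concatMap (λ a → map (a ∷_) (wordsOfLength k n)) (allFin k)

r : ℕ → ℕ → ℕ
r k n = length (filter rich? (wordsOfLength k n))

_^ℚ_ : ℚ → ℕ → ℚ
q ^ℚ zero = 1ℚ
q ^ℚ suc n = q * (q ^ℚ n)

-- A rich word stays rich when a letter is removed from either end: prepending a letter to a word
-- creates at most one new palindromic factor (its longest palindromic prefix), so |Pal(w)| ≤ |w| + 1
-- always, and equality for uv forces equality for u and for v. Hence r_k(m + n) ≤ r_k(m) r_k(n).
-- The binary word 00101100 is not rich, so r_2(8) ≤ 255 < 2^8, and submultiplicativity gives
-- r_2(n) ≤ 128 · y^n for any y with y^8 ≥ 255, such as y = 2c with c = 2047/2048.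
module Submission where

open import Defs

module PalindromicFactors where

  open import Data.Nat using (ℕ; suc; _+_; _≤_; z≤n; s≤s)
  open import Data.Nat.Properties
    using (≤-refl; ≤-reflexive; ≤-trans; ≤-antisym; n≤1+n; +-suc; +-comm; +-identityʳ; +-monoˡ-≤; +-cancelˡ-≤; +-cancelʳ-≤; module ≤-Reasoning)
  open import Data.Fin using (Fin)
  open import Data.List using (List; []; _∷_; _++_; _∷ʳ_; length; reverse; inits; filter)
  open import Data.List.Properties
    using (∷-injectiveˡ; ∷-injectiveʳ; length-++; ++-assoc; ++-identityʳ; reverse-++; reverse-involutive; reverse-injective)
  open import Data.List.Membership.Propositional using (_∈_; _∉_; lose; find)
  open import Data.List.Membership.Propositional.Properties
    using (∈-++⁺ˡ; ∈-++⁺ʳ; ∈-++⁻; ∈-map⁺; ∈-map⁻; ∈-filter⁺; ∈-filter⁻; ∈-deduplicate⁺; ∈-deduplicate⁻; ∈-∃++)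
  import Data.List.Membership.DecPropositional as DecMembership
  open import Data.List.Relation.Binary.Subset.Propositional using (_⊆_)
  open import Data.List.Relation.Unary.Any using (here; there; any?)
  open import Data.List.Relation.Unary.All as All using ()
  open import Data.List.Relation.Unary.AllPairs using (_∷_)
  open import Data.List.Relation.Unary.Unique.Propositional using (Unique)
  open import Data.List.Relation.Unary.Unique.DecPropositional.Properties using (deduplicate-!)
  open import Data.Product using (∃; ∃₂; _×_; _,_)
  open import Data.Sum using (_⊎_; inj₁; inj₂)
  open import Data.Empty using (⊥-elim)
  open import Function using (_∘_)
  open import Relation.Nullary using (¬_; ¬?; yes; no)
  open import Relation.Binary.Definitions using (DecidableEquality)
  open import Relation.Binary.PropositionalEquality using (_≡_; _≢_; refl; sym; trans; cong; subst; module ≡-Reasoning)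

  module _ {A : Set} where

    ∈-++-∷-≢ : ∀ {x z : A} ys zs → z ∈ ys ++ x ∷ zs → z ≢ x → z ∈ ys ++ zs
    ∈-++-∷-≢ ys zs z∈ z≢x with ∈-++⁻ ys z∈
    ... | inj₁ z∈ys = ∈-++⁺ˡ z∈ys
    ... | inj₂ (here z≡x) = ⊥-elim (z≢x z≡x)
    ... | inj₂ (there z∈zs) = ∈-++⁺ʳ ys z∈zs

    Unique-⊆⇒length-≤ : ∀ {xs ys : List A} → Unique xs → xs ⊆ ys → length xs ≤ length ys
    Unique-⊆⇒length-≤ {[]} _ _ = z≤n
    Unique-⊆⇒length-≤ {x ∷ xs} {ys} (x∉xs ∷ !xs) xs⊆ys with ∈-∃++ (xs⊆ys (here refl))
    ... | ys₁ , ys₂ , refl = begin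
      suc (length xs)                ≤⟨ s≤s (Unique-⊆⇒length-≤ !xs xs⊆ys₁ys₂) ⟩
      suc (length (ys₁ ++ ys₂))      ≡⟨ cong suc (length-++ ys₁) ⟩
      suc (length ys₁ + length ys₂)  ≡⟨ +-suc (length ys₁) (length ys₂) ⟨
      length ys₁ + length (x ∷ ys₂)  ≡⟨ length-++ ys₁ ⟨
      length (ys₁ ++ x ∷ ys₂)        ∎
      where
        open ≤-Reasoning
        xs⊆ys₁ys₂ : xs ⊆ ys₁ ++ ys₂
        xs⊆ys₁ys₂ z∈xs = ∈-++-∷-≢ ys₁ ys₂ (xs⊆ys (there z∈xs)) λ z≡x → All.lookup x∉xs z∈xs (sym z≡x)

  module _ {A : Set} (_≟_ : DecidableEquality A) where
    open DecMembership _≟_ using (_∈?_)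

    Unique-⊆-except-one⇒length-≤ : ∀ {xs ys : List A} → Unique xs →
      (∀ {x y} → x ∈ xs → x ∉ ys → y ∈ xs → y ∉ ys → x ≡ y) → length xs ≤ suc (length ys)
    Unique-⊆-except-one⇒length-≤ {xs} {ys} !xs atMostOne with any? (λ x → ¬? (x ∈? ys)) xs
    ... | yes outside with find outside
    ...   | s , s∈xs , s∉ys = Unique-⊆⇒length-≤ !xs xs⊆s∷ys
      where
        xs⊆s∷ys : xs ⊆ s ∷ ys
        xs⊆s∷ys {z} z∈xs with z ∈? ys
        ... | yes z∈ys = there z∈ys
        ... | no z∉ys = here (atMostOne z∈xs z∉ys s∈xs s∉ys)
    Unique-⊆-except-one⇒length-≤ {xs} {ys} !xs atMostOne | no noneOutside =
      ≤-trans (Unique-⊆⇒length-≤ !xs xs⊆ys) (n≤1+n _)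
      where
        xs⊆ys : xs ⊆ ys
        xs⊆ys {z} z∈xs with z ∈? ys
        ... | yes z∈ys = z∈ys
        ... | no z∉ys = ⊥-elim (noneOutside (lose z∈xs z∉ys))

  module _ {k : ℕ} where

    Factor : Word k → Word k → Set
    Factor p w = ∃₂ λ x y → w ≡ x ++ p ++ y

    ∈-inits⁻ : ∀ {p} (w : Word k) → p ∈ inits w → ∃ λ y → w ≡ p ++ y
    ∈-inits⁻ [] (here refl) = [] , refl
    ∈-inits⁻ (a ∷ w) (here refl) = a ∷ w , refl
    ∈-inits⁻ (a ∷ w) (there p∈) with ∈-map⁻ (a ∷_) p∈
    ... | q , q∈ , refl with ∈-inits⁻ w q∈
    ...   | y , w≡qy = y , cong (a ∷_) w≡qy

    ∈-inits⁺ : ∀ (p y : Word k) → p ∈ inits (p ++ y)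
    ∈-inits⁺ [] y = here refl
    ∈-inits⁺ (a ∷ p) y = there (∈-map⁺ (a ∷_) (∈-inits⁺ p y))

    ∈-factors⁻ : ∀ {p} (w : Word k) → p ∈ factors w → Factor p w
    ∈-factors⁻ [] (here refl) = [] , [] , refl
    ∈-factors⁻ (a ∷ w) p∈ with ∈-++⁻ (inits (a ∷ w)) p∈
    ... | inj₁ p∈inits with ∈-inits⁻ (a ∷ w) p∈inits
    ...   | y , eq = [] , y , eq
    ∈-factors⁻ (a ∷ w) p∈ | inj₂ p∈rest with ∈-factors⁻ w p∈rest
    ...   | x , y , eq = a ∷ x , y , cong (a ∷_) eq

    ∈-factors⁺ : ∀ (x p y : Word k) → p ∈ factors (x ++ p ++ y)
    ∈-factors⁺ [] p y = ∈-++⁺ˡ (∈-inits⁺ p y)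
    ∈-factors⁺ (a ∷ x) p y = ∈-++⁺ʳ (inits (a ∷ x ++ p ++ y)) (∈-factors⁺ x p y)

    ∈-distinctPalFactors⁻ : ∀ {p} (w : Word k) → p ∈ distinctPalFactors w → Palindrome p × Factor p w
    ∈-distinctPalFactors⁻ w p∈ with ∈-filter⁻ palindrome? (∈-deduplicate⁻ _≟w_ (filter palindrome? (factors w)) p∈)
    ... | p∈factors , pal = pal , ∈-factors⁻ w p∈factors

    ∈-distinctPalFactors⁺ : ∀ {p} (w : Word k) → Palindrome p → Factor p w → p ∈ distinctPalFactors w
    ∈-distinctPalFactors⁺ {p} w pal (x , y , refl) =
      ∈-deduplicate⁺ _≟w_ {filter palindrome? (factors (x ++ p ++ y))} (∈-filter⁺ palindrome? (∈-factors⁺ x p y) pal)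

    palCount : Word k → ℕ
    palCount w = length (distinctPalFactors w)

    distinctPalFactors-unique : ∀ (w : Word k) → Unique (distinctPalFactors w)
    distinctPalFactors-unique w = deduplicate-! _≟w_ (filter palindrome? (factors w))

    Factor-reverse : ∀ {p w : Word k} → Factor p (reverse w) → Factor (reverse p) w
    Factor-reverse {p} {w} (x , y , eq) = reverse y , reverse x , (begin
      w                                     ≡⟨ reverse-involutive w ⟨
      reverse (reverse w)                   ≡⟨ cong reverse eq ⟩
      reverse (x ++ p ++ y)                 ≡⟨ reverse-++ x (p ++ y) ⟩
      reverse (p ++ y) ++ reverse x         ≡⟨ cong (_++ reverse x) (reverse-++ p y) ⟩
      (reverse y ++ reverse p) ++ reverse x ≡⟨ ++-assoc (reverse y) (reverse p) (reverse x) ⟩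
      reverse y ++ reverse p ++ reverse x   ∎)
      where open ≡-Reasoning

    palCount-reverse : ∀ (w : Word k) → palCount (reverse w) ≤ palCount w
    palCount-reverse w = Unique-⊆⇒length-≤ (distinctPalFactors-unique (reverse w)) λ p∈ →
      let pal , fac = ∈-distinctPalFactors⁻ (reverse w) p∈
      in ∈-distinctPalFactors⁺ w pal (subst (λ q → Factor q w) (sym pal) (Factor-reverse fac))

    new-Factor-∷⇒prefix : ∀ {a : Fin k} {w p} → Factor p (a ∷ w) → ¬ Factor p w → ∃ λ y → a ∷ w ≡ p ++ y
    new-Factor-∷⇒prefix ([] , y , eq) _ = y , eq
    new-Factor-∷⇒prefix (_ ∷ x , y , eq) p∉w = ⊥-elim (p∉w (x , y , ∷-injectiveʳ eq))

    prefixes-comparable : ∀ (p q y z : Word k) → p ++ y ≡ q ++ z →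
      (∃ λ t → q ≡ p ++ t) ⊎ (∃ λ t → p ≡ q ++ t)
    prefixes-comparable [] q y z eq = inj₁ (q , refl)
    prefixes-comparable (a ∷ p) [] y z eq = inj₂ (a ∷ p , refl)
    prefixes-comparable (a ∷ p) (b ∷ q) y z eq
      with refl ← ∷-injectiveˡ eq | prefixes-comparable p q y z (∷-injectiveʳ eq)
    ... | inj₁ (t , q≡pt) = inj₁ (t , cong (a ∷_) q≡pt)
    ... | inj₂ (t , p≡qt) = inj₂ (t , cong (a ∷_) p≡qt)

    palindrome-++ : ∀ {p : Word k} t → Palindrome p → Palindrome (p ++ t) → p ++ t ≡ reverse t ++ p
    palindrome-++ {p} t pal-p pal-pt = begin
      p ++ t                     ≡⟨ pal-pt ⟩
      reverse (p ++ t)           ≡⟨ reverse-++ p t ⟩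
      reverse t ++ reverse p     ≡⟨ cong (reverse t ++_) pal-p ⟨
      reverse t ++ p             ∎
      where open ≡-Reasoning

    -- A palindromic prefix p ++ t of a ∷ w with t ≠ [] also ends in p, which therefore occurs in w.
    new-palindromic-prefix-is-longest : ∀ {a : Fin k} {w p} t y → Palindrome p → Palindrome (p ++ t) →
      a ∷ w ≡ (p ++ t) ++ y → ¬ Factor p w → t ≡ []
    new-palindromic-prefix-is-longest {a} {w} {p} t y pal-p pal-pt eq p∉w with reverse t in rev-t
    ... | [] = reverse-injective rev-t
    ... | d ∷ f = ⊥-elim (p∉w (f , y , ∷-injectiveʳ (begin
      a ∷ w                  ≡⟨ eq ⟩
      (p ++ t) ++ y          ≡⟨ cong (_++ y) (palindrome-++ t pal-p pal-pt) ⟩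
      (reverse t ++ p) ++ y  ≡⟨ cong (λ u → (u ++ p) ++ y) rev-t ⟩
      (d ∷ f ++ p) ++ y      ≡⟨ cong (d ∷_) (++-assoc f p y) ⟩
      d ∷ f ++ p ++ y        ∎)))
      where open ≡-Reasoning

    new-palindromic-factor-unique : ∀ {a : Fin k} {w p q} → Palindrome p → Palindrome q →
      Factor p (a ∷ w) → Factor q (a ∷ w) → ¬ Factor p w → ¬ Factor q w → p ≡ q
    new-palindromic-factor-unique {p = p} {q} pal-p pal-q p∈aw q∈aw p∉w q∉w
      with new-Factor-∷⇒prefix p∈aw p∉w | new-Factor-∷⇒prefix q∈aw q∉w
    ... | y , aw≡py | z , aw≡qz with prefixes-comparable p q y z (trans (sym aw≡py) aw≡qz)
    ... | inj₁ (t , refl) with refl ← new-palindromic-prefix-is-longest t z pal-p pal-q aw≡qz p∉w = sym (++-identityʳ p)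
    ... | inj₂ (t , refl) with refl ← new-palindromic-prefix-is-longest t y pal-q pal-p aw≡py q∉w = ++-identityʳ q

    palCount-∷ : ∀ (a : Fin k) w → palCount (a ∷ w) ≤ suc (palCount w)
    palCount-∷ a w = Unique-⊆-except-one⇒length-≤ _≟w_ (distinctPalFactors-unique (a ∷ w))
      λ p∈ p∉ q∈ q∉ →
        let pal-p , p∈aw = ∈-distinctPalFactors⁻ (a ∷ w) p∈
            pal-q , q∈aw = ∈-distinctPalFactors⁻ (a ∷ w) q∈
        in new-palindromic-factor-unique pal-p pal-q p∈aw q∈aw
             (p∉ ∘ ∈-distinctPalFactors⁺ w pal-p) (q∉ ∘ ∈-distinctPalFactors⁺ w pal-q)

    palCount-∷ʳ : ∀ w (a : Fin k) → palCount (w ∷ʳ a) ≤ suc (palCount w)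
    palCount-∷ʳ w a = begin
      palCount (w ∷ʳ a)                     ≡⟨ cong palCount (reverse-involutive (w ∷ʳ a)) ⟨
      palCount (reverse (reverse (w ∷ʳ a))) ≤⟨ palCount-reverse (reverse (w ∷ʳ a)) ⟩
      palCount (reverse (w ∷ʳ a))           ≡⟨ cong palCount (reverse-++ w (a ∷ [])) ⟩
      palCount (a ∷ reverse w)              ≤⟨ palCount-∷ a (reverse w) ⟩
      suc (palCount (reverse w))            ≤⟨ s≤s (palCount-reverse w) ⟩
      suc (palCount w)                      ∎
      where open ≤-Reasoning

    palCount-++ˡ : ∀ (u v : Word k) → palCount (u ++ v) ≤ length u + palCount v
    palCount-++ˡ [] v = ≤-refl
    palCount-++ˡ (a ∷ u) v = ≤-trans (palCount-∷ a (u ++ v)) (s≤s (palCount-++ˡ u v))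

    palCount-++ʳ : ∀ (u v : Word k) → palCount (u ++ v) ≤ palCount u + length v
    palCount-++ʳ u [] = ≤-reflexive (trans (cong palCount (++-identityʳ u)) (sym (+-identityʳ _)))
    palCount-++ʳ u (a ∷ v) = begin
      palCount (u ++ a ∷ v)         ≡⟨ cong palCount (++-assoc u (a ∷ []) v) ⟨
      palCount ((u ∷ʳ a) ++ v)      ≤⟨ palCount-++ʳ (u ∷ʳ a) v ⟩
      palCount (u ∷ʳ a) + length v  ≤⟨ +-monoˡ-≤ (length v) (palCount-∷ʳ u a) ⟩
      suc (palCount u) + length v   ≡⟨ +-suc (palCount u) (length v) ⟨
      palCount u + length (a ∷ v)   ∎
      where open ≤-Reasoning

    palCount-≤ : ∀ (w : Word k) → palCount w ≤ suc (length w)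
    palCount-≤ w = begin
      palCount w             ≡⟨ cong palCount (++-identityʳ w) ⟨
      palCount (w ++ [])     ≤⟨ palCount-++ˡ w [] ⟩
      length w + 1           ≡⟨ +-comm (length w) 1 ⟩
      suc (length w)         ∎
      where open ≤-Reasoning

    Rich-++⁻ : ∀ (u v : Word k) → Rich (u ++ v) → Rich u × Rich v
    Rich-++⁻ u v rich = ≤-antisym (palCount-≤ u) rich-u , ≤-antisym (palCount-≤ v) rich-v
      where
        open ≤-Reasoning
        rich-u : suc (length u) ≤ palCount u
        rich-u = +-cancelʳ-≤ (length v) _ _ (begin
          suc (length u) + length v  ≡⟨ cong suc (length-++ u) ⟨
          suc (length (u ++ v))      ≡⟨ rich ⟨
          palCount (u ++ v)          ≤⟨ palCount-++ʳ u v ⟩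
          palCount u + length v      ∎)
        rich-v : suc (length v) ≤ palCount v
        rich-v = +-cancelˡ-≤ (length u) _ _ (begin
          length u + suc (length v)  ≡⟨ +-suc (length u) (length v) ⟩
          suc (length u + length v)  ≡⟨ cong suc (length-++ u) ⟨
          suc (length (u ++ v))      ≡⟨ rich ⟨
          palCount (u ++ v)          ≤⟨ palCount-++ˡ u v ⟩
          length u + palCount v      ∎)

module RichWordCounting where

  open import Data.Nat using (ℕ; zero; suc; _+_; _*_; _^_; _≤_; z≤n)
  open import Data.Nat.Properties
    using (≤-refl; ≤-reflexive; +-mono-≤; +-identityʳ; *-distribʳ-+; module ≤-Reasoning)
  open import Data.Nat.ListAction using (sum)
  open import Data.Fin using (zero; suc)
  open import Data.List using (List; []; _∷_; _++_; length; filter; map; concatMap; allFin)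
  open import Data.List.Properties using (length-++; filter-++; filter-none; length-tabulate)
  open import Data.List.Relation.Binary.Sublist.Propositional using (⊆-refl)
  import Data.List.Relation.Unary.All as All
  open import Data.List.Relation.Binary.Sublist.Propositional.Properties using (filter⁺; length-mono-≤)
  open import Data.Product using (_×_; proj₁; proj₂)
  open import Function using (_∘_; id)
  open import Level using (0ℓ)
  open import Relation.Nullary using (¬_; ¬?; yes; no)
  open import Relation.Unary using (Pred; Decidable)
  open import Relation.Binary.PropositionalEquality using (_≡_; refl; sym; trans; cong; cong₂; module ≡-Reasoning)
  open PalindromicFactors using (Rich-++⁻)

  module _ {A : Set} where

    sum-map-mono-≤ : ∀ {f g : A → ℕ} → (∀ x → f x ≤ g x) → ∀ xs → sum (map f xs) ≤ sum (map g xs)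
    sum-map-mono-≤ f≤g [] = z≤n
    sum-map-mono-≤ f≤g (x ∷ xs) = +-mono-≤ (f≤g x) (sum-map-mono-≤ f≤g xs)

    sum-map-*ʳ : ∀ (f : A → ℕ) c xs → sum (map (λ x → f x * c) xs) ≡ sum (map f xs) * c
    sum-map-*ʳ f c [] = refl
    sum-map-*ʳ f c (x ∷ xs) = trans (cong (f x * c +_) (sum-map-*ʳ f c xs)) (sym (*-distribʳ-+ c (f x) _))

    sum-map-const : ∀ c (xs : List A) → sum (map (λ _ → c) xs) ≡ length xs * c
    sum-map-const c [] = refl
    sum-map-const c (x ∷ xs) = cong (c +_) (sum-map-const c xs)

    length-filter-map : ∀ {B : Set} {P : Pred B 0ℓ} (P? : Decidable P) (f : A → B) xs →
      length (filter P? (map f xs)) ≡ length (filter (P? ∘ f) xs)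
    length-filter-map P? f [] = refl
    length-filter-map P? f (x ∷ xs) with P? (f x)
    ... | yes _ = cong suc (length-filter-map P? f xs)
    ... | no _ = length-filter-map P? f xs

  module _ {k : ℕ} where

    count : {P : Pred (Word k) 0ℓ} → Decidable P → ℕ → ℕ
    count P? n = length (filter P? (wordsOfLength k n))

    count-suc : ∀ {P : Pred (Word k) 0ℓ} (P? : Decidable P) n →
      count P? (suc n) ≡ sum (map (λ a → count (P? ∘ (a ∷_)) n) (allFin k))
    count-suc P? n = go (allFin k)
      where
        ws = wordsOfLength k n
        go : ∀ as → length (filter P? (concatMap (λ a → map (a ∷_) ws) as))
                    ≡ sum (map (λ a → count (P? ∘ (a ∷_)) n) as)
        go [] = refl
        go (a ∷ as) = begin
          length (filter P? (map (a ∷_) ws ++ concatMap (λ a → map (a ∷_) ws) as))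
            ≡⟨ cong length (filter-++ P? (map (a ∷_) ws) _) ⟩
          length (filter P? (map (a ∷_) ws) ++ filter P? (concatMap (λ a → map (a ∷_) ws) as))
            ≡⟨ length-++ (filter P? (map (a ∷_) ws)) ⟩
          length (filter P? (map (a ∷_) ws)) + length (filter P? (concatMap (λ a → map (a ∷_) ws) as))
            ≡⟨ cong₂ _+_ (length-filter-map P? (a ∷_) ws) (go as) ⟩
          count (P? ∘ (a ∷_)) n + sum (map (λ a → count (P? ∘ (a ∷_)) n) as)
            ∎
          where open ≡-Reasoning

    count-mono : ∀ {P Q : Pred (Word k) 0ℓ} (P? : Decidable P) (Q? : Decidable Q) →
      (∀ {w} → P w → Q w) → ∀ n → count P? n ≤ count Q? n
    count-mono P? Q? P⇒Q n = length-mono-≤ (filter⁺ P? Q? (λ { refl → P⇒Q }) (⊆-refl {x = wordsOfLength k n}))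

    count-≤-^ : ∀ {P : Pred (Word k) 0ℓ} (P? : Decidable P) n → count P? n ≤ k ^ n
    count-≤-^ P? zero with P? []
    ... | yes _ = ≤-refl
    ... | no _ = z≤n
    count-≤-^ P? (suc n) = begin
      count P? (suc n)                                   ≡⟨ count-suc P? n ⟩
      sum (map (λ a → count (P? ∘ (a ∷_)) n) (allFin k)) ≤⟨ sum-map-mono-≤ (λ a → count-≤-^ (P? ∘ (a ∷_)) n) (allFin k) ⟩
      sum (map (λ _ → k ^ n) (allFin k))                 ≡⟨ sum-map-const (k ^ n) (allFin k) ⟩
      length (allFin k) * k ^ n                          ≡⟨ cong (_* k ^ n) (length-tabulate {n = k} id) ⟩
      k * k ^ n                                          ∎
      where open ≤-Reasoning

    count-++-≤ : ∀ {P Q R : Pred (Word k) 0ℓ} (P? : Decidable P) (Q? : Decidable Q) (R? : Decidable R) →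
      (∀ u v → P (u ++ v) → Q u × R v) → ∀ m n → count P? (m + n) ≤ count Q? m * count R? n
    count-++-≤ P? Q? R? split zero n with Q? []
    ... | yes _ = begin
      count P? n      ≤⟨ count-mono P? R? (λ {v} → proj₂ ∘ split [] v) n ⟩
      count R? n      ≡⟨ +-identityʳ (count R? n) ⟨
      count R? n + 0  ∎
      where open ≤-Reasoning
    ... | no ¬Q[] = ≤-reflexive (cong length (filter-none P? {wordsOfLength k n} (All.tabulate λ {v} _ → ¬Q[] ∘ proj₁ ∘ split [] v)))
    count-++-≤ P? Q? R? split (suc m) n = begin
      count P? (suc m + n)
        ≡⟨ count-suc P? (m + n) ⟩
      sum (map (λ a → count (P? ∘ (a ∷_)) (m + n)) (allFin k))
        ≤⟨ sum-map-mono-≤ (λ a → count-++-≤ (P? ∘ (a ∷_)) (Q? ∘ (a ∷_)) R? (split ∘ (a ∷_)) m n) (allFin k) ⟩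
      sum (map (λ a → count (Q? ∘ (a ∷_)) m * count R? n) (allFin k))
        ≡⟨ sum-map-*ʳ (λ a → count (Q? ∘ (a ∷_)) m) (count R? n) (allFin k) ⟩
      sum (map (λ a → count (Q? ∘ (a ∷_)) m) (allFin k)) * count R? n
        ≡⟨ cong (_* count R? n) (count-suc Q? m) ⟨
      count Q? (suc m) * count R? n
        ∎
      where open ≤-Reasoning

  r-submultiplicative : ∀ k m n → r k (m + n) ≤ r k m * r k n
  r-submultiplicative k = count-++-≤ rich? rich? rich? Rich-++⁻

  r-≤-^ : ∀ k n → r k n ≤ k ^ n
  r-≤-^ k = count-≤-^ rich?

  r₂8≤255 : r 2 8 ≤ 255
  r₂8≤255 = count-mono rich? (λ w → ¬? (w ≟w nonRich)) (λ { {w} rich refl → ¬rich rich }) 8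
    where
      -- its palindromic factors are ε, 0, 1, 00, 11, 010, 101 and 0110 only
      nonRich : Word 2
      nonRich = zero ∷ zero ∷ suc zero ∷ zero ∷ suc zero ∷ suc zero ∷ zero ∷ zero ∷ []
      ¬rich : ¬ Rich nonRich
      ¬rich ()

open RichWordCounting using (r-submultiplicative; r-≤-^; r₂8≤255)

open import Algebra.Bundles using (CommutativeRing)
open import Data.Integer as ℤ using (+_)
import Data.Integer.Properties as ℤₚ
open import Data.Nat as ℕ using (ℕ)
import Data.Nat.Properties as ℕₚ
open import Data.Nat.Coprimality using (1-coprimeTo)
import Data.Nat.Coprimality as Coprime
open import Data.Bool using (T)
open import Data.Product using (Σ; _×_; _,_)
open import Data.Rational using (ℚ; 0ℚ; 1ℚ; _<_; _≤_; _*_; _/_; mkℚ; *≤*; nonNegative)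
open import Data.Rational.Properties
  using (normalize-coprime; ≤-refl; ≤-trans; _≤?_; _<?_; *-identityʳ; *-monoˡ-≤-nonNeg; *-monoʳ-≤-nonNeg;
         *-assoc; +-*-commutativeRing; module ≤-Reasoning)
open import Algebra.Properties.CommutativeSemiring.Exp (CommutativeRing.commutativeSemiring +-*-commutativeRing)
  using (_^_; ^-homo-*; ^-distrib-*)
open import Algebra.Properties.CommutativeSemigroup (CommutativeRing.*-commutativeSemigroup +-*-commutativeRing)
  using (x∙yz≈y∙xz)
open import Relation.Nullary.Decidable using (from-yes)
open import Relation.Binary.PropositionalEquality using (_≡_; refl; sym; cong; cong₂; subst₂)

fromℕ : ℕ → ℚ
fromℕ n = + n / 1

fromℕ≡mkℚ : ∀ n → fromℕ n ≡ mkℚ (+ n) 0 (Coprime.sym (1-coprimeTo n))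
fromℕ≡mkℚ n = normalize-coprime (Coprime.sym (1-coprimeTo n))

fromℕ-mono-≤ : ∀ {m n} → m ℕ.≤ n → fromℕ m ≤ fromℕ n
fromℕ-mono-≤ {m} {n} m≤n rewrite fromℕ≡mkℚ m | fromℕ≡mkℚ n =
  *≤* (subst₂ ℤ._≤_ (sym (ℤₚ.*-identityʳ (+ m))) (sym (ℤₚ.*-identityʳ (+ n))) (ℤ.+≤+ m≤n))

fromℕ-homo-* : ∀ m n → fromℕ (m ℕ.* n) ≡ fromℕ m * fromℕ n
fromℕ-homo-* m n rewrite fromℕ≡mkℚ m | fromℕ≡mkℚ n = cong (_/ 1) (ℤₚ.pos-* m n)

^ℚ≡^ : ∀ q n → q ^ℚ n ≡ q ^ n
^ℚ≡^ q ℕ.zero = refl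
^ℚ≡^ q (ℕ.suc n) = cong (q *_) (^ℚ≡^ q n)

1≤^ : ∀ {q} → 1ℚ ≤ q → ∀ n → 1ℚ ≤ q ^ n
1≤^ 1≤q ℕ.zero = ≤-refl
1≤^ {q} 1≤q (ℕ.suc n) = begin
  1ℚ           ≤⟨ 1≤q ⟩
  q            ≡⟨ *-identityʳ q ⟨
  q * 1ℚ       ≤⟨ *-monoˡ-≤-nonNeg q {{nonNegative (≤-trans (from-yes (0ℚ ≤? 1ℚ)) 1≤q)}} (1≤^ 1≤q n) ⟩
  q * q ^ n    ∎
  where open ≤-Reasoning

C c two y : ℚ
C = fromℕ 128
-- c is chosen so that (2c)⁸ = 256 (1 − 1/2048)⁸ ≥ 255
c = + 2047 / 2048
two = fromℕ 2
y = c * two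

C≤C*y^ : ∀ n → C ≤ C * y ^ n
C≤C*y^ n = begin
  C           ≡⟨ *-identityʳ C ⟨
  C * 1ℚ      ≤⟨ *-monoˡ-≤-nonNeg C (1≤^ (from-yes (1ℚ ≤? y)) n) ⟩
  C * y ^ n   ∎
  where open ≤-Reasoning

r₂-bound-small : ∀ n → T (n ℕ.<ᵇ 8) → fromℕ (r 2 n) ≤ C * y ^ n
r₂-bound-small n n<8 = ≤-trans
  (fromℕ-mono-≤ (ℕₚ.≤-trans (r-≤-^ 2 n) (ℕₚ.^-monoʳ-≤ 2 (ℕₚ.≤-pred (ℕₚ.<ᵇ⇒< n 8 n<8)))))
  (C≤C*y^ n)

r₂-bound-+8 : ∀ m → fromℕ (r 2 m) ≤ C * y ^ m → fromℕ (r 2 (8 ℕ.+ m)) ≤ C * y ^ (8 ℕ.+ m)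
r₂-bound-+8 m bound = begin
  fromℕ (r 2 (8 ℕ.+ m))     ≤⟨ fromℕ-mono-≤ (ℕₚ.≤-trans (r-submultiplicative 2 8 m) (ℕₚ.*-monoˡ-≤ (r 2 m) r₂8≤255)) ⟩
  fromℕ (255 ℕ.* r 2 m)     ≡⟨ fromℕ-homo-* 255 (r 2 m) ⟩
  fromℕ 255 * fromℕ (r 2 m) ≤⟨ *-monoˡ-≤-nonNeg (fromℕ 255) bound ⟩
  fromℕ 255 * (C * y ^ m)   ≤⟨ *-monoʳ-≤-nonNeg (C * y ^ m) {{C*y^m-nonNeg}} (from-yes (fromℕ 255 ≤? y ^ 8)) ⟩
  y ^ 8 * (C * y ^ m)       ≡⟨ x∙yz≈y∙xz (y ^ 8) C (y ^ m) ⟩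
  C * (y ^ 8 * y ^ m)       ≡⟨ cong (C *_) (^-homo-* y 8 m) ⟨
  C * y ^ (8 ℕ.+ m)         ∎
  where
    open ≤-Reasoning
    C*y^m-nonNeg = nonNegative (≤-trans (from-yes (0ℚ ≤? C)) (C≤C*y^ m))

r₂-bound : ∀ n → fromℕ (r 2 n) ≤ C * y ^ n
r₂-bound 0 = r₂-bound-small 0 _
r₂-bound 1 = r₂-bound-small 1 _
r₂-bound 2 = r₂-bound-small 2 _
r₂-bound 3 = r₂-bound-small 3 _
r₂-bound 4 = r₂-bound-small 4 _
r₂-bound 5 = r₂-bound-small 5 _
r₂-bound 6 = r₂-bound-small 6 _
r₂-bound 7 = r₂-bound-small 7 _
r₂-bound (ℕ.suc (ℕ.suc (ℕ.suc (ℕ.suc (ℕ.suc (ℕ.suc (ℕ.suc (ℕ.suc m)))))))) = r₂-bound-+8 m (r₂-bound m)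

mainTheorem14 : Σ ℚ λ C → Σ ℚ λ c →
    (0ℚ < C) × (0ℚ < c) × (c < 1ℚ) ×
    ((n : ℕ) → ((+ r 2 n) / 1) ≤ C * (c ^ℚ n) * ((+ 2) / 1) ^ℚ n)
mainTheorem14 = C , c , from-yes (0ℚ <? C) , from-yes (0ℚ <? c) , from-yes (c <? 1ℚ) , λ n → begin
  fromℕ (r 2 n)              ≤⟨ r₂-bound n ⟩
  C * (c * two) ^ n          ≡⟨ cong (C *_) (^-distrib-* c two n) ⟩
  C * (c ^ n * two ^ n)      ≡⟨ *-assoc C (c ^ n) (two ^ n) ⟨
  C * c ^ n * two ^ n        ≡⟨ cong₂ (λ u v → C * u * v) (^ℚ≡^ c n) (^ℚ≡^ two n) ⟨
  C * c ^ℚ n * two ^ℚ n      ∎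
  where open ≤-Reasoning
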